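{- For integers $n\ge 0$, $k>0$ and $m\ge 0$, \[ \mathcal{C}_n^k(m)=\mathcal{C}_n^{k-1}(m)+\sum_{j=1}^{n}\binom{n}{j}\mathcal{C}_{n-j+1}^{k-1}(m)+m\sum_{j=1}^{n}\binom{n}{j}\mathcal{C}_{n-j}^{k-1}(m). \]
   Context: Callan sequences: for integers $n,k\ge 0$ let $N=\{1,\dots,n\}\cup\{*\}$ (red elements) and $K=\{1,\dots,k\}\cup\{*'\}$ (blue elements). A Callan sequence of size $n\times k$ consists of an integer $r\ge 0$, a set partition of $N$ into $r+1$ nonempty blocks $R_1,\dots,R_r,R^*$ with $*\in R^*$, and a set partition of $K$ into $r+1$ nonempty blocks $B_1,\dots,B_r,B^*$ with $*'\in B^*$, arranged as the ordered list of $r$ ordinary pairs $(B_1;R_1)\cdots(B_r;R_r)$ together with the extra pair $(B^*;R^*)$; the order of the ordinary pairs matters. For $m\ge0$ an $m$-barred Callan sequence is a Callan sequence together with $m$ indistinguishable bars placed in the $r+1$ gaps before, between and after the ordinary pairs (several bars per gap allowed). For $n,k>0$, $\mathcal{C}_n^k(m)$ denotes the number of $m$-barred Callan sequences of size $n\times k$; by convention $\mathcal{C}_n^0(m)=\mathcal{C}_0^k(m)=1$ for all $n,k\ge 0$. -}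

module Defs where

open import Data.Nat using (ℕ; zero; suc; _+_; _*_)
open import Data.Nat.Combinatorics using (_C_)
open import Data.Bool using (Bool; true; false; _∧_)
open import Data.Fin as Fin using (Fin)
open import Data.Vec as Vec using (Vec; []; _∷_)
open import Data.List as List using (List; [_]; concatMap; filterᵇ; length; map; allFin; upTo; applyUpTo)
open import Data.Nat.ListAction using (sum)
open import Data.Bool.ListAction using (all; any)
open import Data.Product using (_×_; _,_)
open import Relation.Nullary.Decidable using (⌊_⌋)

-- All vectors of length a with entries in Fin b
-- (a vector v encodes the map i ↦ v[i] from an (a)-element set to Fin b).
allFinVecs : (b a : ℕ) → List (Vec (Fin b) a)
allFinVecs b zero    = [ [] ]
allFinVecs b (suc a) = concatMap (λ x → map (x ∷_) (allFinVecs b a)) (allFin b)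

boundedVecs : (m a : ℕ) → List (Vec ℕ a)
boundedVecs m zero    = [ [] ]
boundedVecs m (suc a) = concatMap (λ x → map (x ∷_) (boundedVecs m a)) (upTo (suc m))

surjective? : ∀ {a b} → Vec (Fin b) a → Bool
surjective? {a} {b} v = all (λ j → any (λ x → ⌊ j Fin.≟ x ⌋) (Vec.toList v)) (allFin b)

-- An m-barred Callan sequence of size n×k with r ordinary pairs is encoded as
--   red  : Vec (Fin (suc r)) (suc n)   -- position 0 is *, position i is red element i;
--                                        value 0 means block R*, value i ∈ {1..r} means R_i
--   blue : Vec (Fin (suc r)) (suc k)   -- position 0 is *', likewise for B*, B_i
--   bars : Vec ℕ (suc r)               -- number of bars in each of the r+1 gaps
-- subject to: * ∈ R*, *' ∈ B*, both maps surjective (all blocks nonempty),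
-- and the total number of bars equals m.
-- Ordinary pair i is (B_i ; R_i), so the order of ordinary pairs is recorded.
CallanData : (n k r : ℕ) → Set
CallanData n k r = Vec (Fin (suc r)) (suc n) × Vec (Fin (suc r)) (suc k) × Vec ℕ (suc r)

isBarredCallan : (n k m r : ℕ) → CallanData n k r → Bool
isBarredCallan n k m r (red , blue , bars) =
  ⌊ Vec.head red Fin.≟ Fin.zero ⌋ ∧ ⌊ Vec.head blue Fin.≟ Fin.zero ⌋
  ∧ surjective? red ∧ surjective? blue ∧ ⌊ Vec.sum bars Data.Nat.≟ m ⌋
  where import Data.Nat

allCallanData : (n k m r : ℕ) → List (CallanData n k r)
allCallanData n k m r =
  concatMap (λ red → concatMap (λ blue → map (λ bars → red , blue , bars)
              (boundedVecs m (suc r)))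
            (allFinVecs (suc r) (suc k)))
   (allFinVecs (suc r) (suc n))

countR : (n k m r : ℕ) → ℕ
countR n k m r = length (filterᵇ (isBarredCallan n k m r) (allCallanData n k m r))

-- r ranges over 0..n (r+1 nonempty blocks of an (n+1)-set forces r ≤ n).
countBarredCallan : (n k m : ℕ) → ℕ
countBarredCallan n k m = sum (map (countR n k m) (upTo (suc n)))

-- 𝒞_n^k(m), with the convention 𝒞_n^0(m) = 𝒞_0^k(m) = 1.
𝒞 : (n k m : ℕ) → ℕ
𝒞 zero    k       m = 1
𝒞 (suc n) zero    m = 1
𝒞 (suc n) (suc k) m = countBarredCallan (suc n) (suc k) m

Σ₁ : ℕ → (ℕ → ℕ) → ℕ
Σ₁ n f = sum (map f (applyUpTo suc n))

module Submission where

-- An m-barred Callan sequence with r ordinary pairs is three independent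
-- choices: the red partition, the blue partition and the bars.  Hence
--   𝒞 n k m = Σ_{r ≤ n} a(n,r) · a(k,r) · u(r,m),
-- where a(n,r) ("blocks") counts maps {1..n} → {0..r} hitting each of 1..r (element i
-- goes to block R_i, 0 standing for R*) and u(r,m) = C(r+m,m) ("bars") counts placements
-- of m bars into r+1 gaps.
-- The recurrence then follows from three facts about the factors:
--   a(k+1,r) = (r+1)·a(k,r) + r·a(k,r-1)          (where the new element goes),
--   Σ_{i ≤ n} C(n,i)·a(i,r) = a(n,r) + a(n,r+1)     (binomial transform of a),
--   (r+1)·u(r+1,m) = (r+1+m)·u(r,m)                 (ratio of binomials),
-- which let both sides of the theorem be rewritten as the same sum over r.

open import Defs
open import Data.Nat using (ℕ; zero; suc; _+_; _*_; _∸_; _<_; _≤_; z≤n; s≤s; _≡ᵇ_; _!)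
open import Data.Nat.Properties
open import Data.Nat.Combinatorics using (_C_; k>n⇒nCk≡0; nCk≡nC[n∸k]; nCk+nC[k+1]≡[n+1]C[k+1])
open import Data.Nat.Tactic.RingSolver using (solve-∀)
open import Data.Bool using (Bool; true; false; _∧_; _∨_; not)
open import Data.Bool.Properties using (∧-zeroʳ; ∧-identityʳ)
open import Data.Fin as Fin using (Fin)
import Data.Fin.Properties as FinP
open import Data.Vec as Vec using (Vec; []; _∷_)
import Data.Vec.Properties as VecP
open import Data.List using (List; _∷_; []; _++_; concatMap; filterᵇ; length; map; allFin; upTo; applyUpTo; tabulate)
open import Data.Nat.ListAction using (sum)
open import Data.Bool.ListAction using (all; any)
open import Data.Product using (_,_)
open import Relation.Nullary.Decidable using (⌊_⌋; ⌊⌋-map′; T?)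
open import Relation.Binary.PropositionalEquality
open import Function using (_∘_; id)

Σ< : ℕ → (ℕ → ℕ) → ℕ
Σ< zero    f = 0
Σ< (suc N) f = f 0 + Σ< N (f ∘ suc)

sum-applyUpTo : ∀ N (g f : ℕ → ℕ) → sum (map f (applyUpTo g N)) ≡ Σ< N (f ∘ g)
sum-applyUpTo zero    g f = refl
sum-applyUpTo (suc N) g f = cong (f (g 0) +_) (sum-applyUpTo N (g ∘ suc) f)

Σ<-cong< : ∀ N {f g : ℕ → ℕ} → (∀ i → i < N → f i ≡ g i) → Σ< N f ≡ Σ< N g
Σ<-cong< zero    e = refl
Σ<-cong< (suc N) e = cong₂ _+_ (e 0 (s≤s z≤n)) (Σ<-cong< N (λ i i<N → e (suc i) (s≤s i<N)))

Σ<-cong : ∀ N {f g : ℕ → ℕ} → (∀ i → f i ≡ g i) → Σ< N f ≡ Σ< N g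
Σ<-cong N e = Σ<-cong< N (λ i _ → e i)

Σ<-zeros : ∀ N → Σ< N (λ _ → 0) ≡ 0
Σ<-zeros zero    = refl
Σ<-zeros (suc N) = Σ<-zeros N

Σ<-snoc : ∀ N (f : ℕ → ℕ) → Σ< (suc N) f ≡ Σ< N f + f N
Σ<-snoc zero    f = +-comm (f 0) 0
Σ<-snoc (suc N) f = trans (cong (f 0 +_) (Σ<-snoc N (f ∘ suc))) (sym (+-assoc (f 0) _ _))

Σ<-+ : ∀ N (f g : ℕ → ℕ) → Σ< N (λ i → f i + g i) ≡ Σ< N f + Σ< N g
Σ<-+ zero    f g = refl
Σ<-+ (suc N) f g =
  trans (cong (f 0 + g 0 +_) (Σ<-+ N (f ∘ suc) (g ∘ suc)))
        (interchange (f 0) (g 0) (Σ< N (f ∘ suc)) (Σ< N (g ∘ suc)))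
  where
  interchange : ∀ a b c d → a + b + (c + d) ≡ a + c + (b + d)
  interchange = solve-∀

Σ<-*ˡ : ∀ N (c : ℕ) (f : ℕ → ℕ) → Σ< N (λ i → c * f i) ≡ c * Σ< N f
Σ<-*ˡ zero    c f = sym (*-zeroʳ c)
Σ<-*ˡ (suc N) c f = trans (cong (c * f 0 +_) (Σ<-*ˡ N c (f ∘ suc))) (sym (*-distribˡ-+ c (f 0) _))

Σ<-*ʳ : ∀ N (c : ℕ) (f : ℕ → ℕ) → Σ< N (λ i → f i * c) ≡ Σ< N f * c
Σ<-*ʳ N c f = trans (Σ<-cong N (λ i → *-comm (f i) c)) (trans (Σ<-*ˡ N c f) (*-comm c _))

Σ<-reverse : ∀ N (f : ℕ → ℕ) → Σ< (suc N) f ≡ Σ< (suc N) (λ j → f (N ∸ j))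
Σ<-reverse zero    f = refl
Σ<-reverse (suc N) f =
  trans (Σ<-snoc (suc N) f) (trans (+-comm _ (f (suc N))) (cong (f (suc N) +_) (Σ<-reverse N f)))

Σ<-extend : ∀ {M N} (f : ℕ → ℕ) → M ≤ N → (∀ i → M ≤ i → f i ≡ 0) → Σ< N f ≡ Σ< M f
Σ<-extend {M} {N} f M≤N vanish = subst (λ L → Σ< L f ≡ Σ< M f) (m+[n∸m]≡n M≤N) (pad (N ∸ M))
  where
  open ≡-Reasoning
  pad : ∀ d → Σ< (M + d) f ≡ Σ< M f
  pad zero    = cong (λ L → Σ< L f) (+-identityʳ M)
  pad (suc d) = begin
    Σ< (M + suc d) f          ≡⟨ cong (λ L → Σ< L f) (+-suc M d) ⟩
    Σ< (suc (M + d)) f        ≡⟨ Σ<-snoc (M + d) f ⟩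
    Σ< (M + d) f + f (M + d)  ≡⟨ cong₂ _+_ (pad d) (vanish (M + d) (m≤m+n M d)) ⟩
    Σ< M f + 0                ≡⟨ +-identityʳ _ ⟩
    Σ< M f                    ∎

Σ<-swap : ∀ N M (F : ℕ → ℕ → ℕ) → Σ< N (λ j → Σ< M (F j)) ≡ Σ< M (λ r → Σ< N (λ j → F j r))
Σ<-swap zero    M F = sym (Σ<-zeros M)
Σ<-swap (suc N) M F =
  trans (cong (Σ< M (F 0) +_) (Σ<-swap N M (F ∘ suc)))
        (sym (Σ<-+ M (F 0) (λ r → Σ< N (λ j → F (suc j) r))))

binom : (ℕ → ℕ) → ℕ → ℕ
binom f n = Σ< (suc n) (λ i → (n C i) * f i)

binom-cong : ∀ n {f g : ℕ → ℕ} → (∀ i → f i ≡ g i) → binom f n ≡ binom g n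
binom-cong n e = Σ<-cong (suc n) (λ i → cong ((n C i) *_) (e i))

binom-+ : ∀ n (f g : ℕ → ℕ) → binom (λ i → f i + g i) n ≡ binom f n + binom g n
binom-+ n f g =
  trans (Σ<-cong (suc n) (λ i → *-distribˡ-+ (n C i) (f i) (g i)))
        (Σ<-+ (suc n) (λ i → (n C i) * f i) (λ i → (n C i) * g i))

binom-* : ∀ n (c : ℕ) (f : ℕ → ℕ) → binom (λ i → c * f i) n ≡ c * binom f n
binom-* n c f =
  trans (Σ<-cong (suc n) (λ i → x*[y*z]≡y*[x*z] (n C i) c (f i)))
        (Σ<-*ˡ (suc n) c (λ i → (n C i) * f i))
  where
  x*[y*z]≡y*[x*z] : ∀ x y z → x * (y * z) ≡ y * (x * z)
  x*[y*z]≡y*[x*z] = solve-∀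

-- Pascal's rule C(n+1,i+1) = C(n,i) + C(n,i+1), transported to the transform.
binom-suc : ∀ (f : ℕ → ℕ) n → binom f (suc n) ≡ binom f n + binom (f ∘ suc) n
binom-suc f n = begin
  1 * f 0 + Σ< (suc n) (λ i → (suc n C suc i) * f (suc i))
    ≡⟨ cong (1 * f 0 +_) (trans (Σ<-cong (suc n) pascal)
         (Σ<-+ (suc n) (λ i → (n C i) * f (suc i)) (λ i → (n C suc i) * f (suc i)))) ⟩
  1 * f 0 + (binom (f ∘ suc) n + Σ< (suc n) (λ i → (n C suc i) * f (suc i)))
    ≡⟨ rearrange (1 * f 0) (binom (f ∘ suc) n) _ ⟩
  Σ< (suc (suc n)) (λ i → (n C i) * f i) + binom (f ∘ suc) n
    ≡⟨ cong (_+ binom (f ∘ suc) n) (Σ<-snoc (suc n) (λ i → (n C i) * f i)) ⟩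
  binom f n + (n C suc n) * f (suc n) + binom (f ∘ suc) n
    ≡⟨ cong (λ c → binom f n + c * f (suc n) + binom (f ∘ suc) n) (k>n⇒nCk≡0 (n<1+n n)) ⟩
  binom f n + 0 + binom (f ∘ suc) n
    ≡⟨ cong (_+ binom (f ∘ suc) n) (+-identityʳ (binom f n)) ⟩
  binom f n + binom (f ∘ suc) n ∎
  where
  open ≡-Reasoning
  pascal : ∀ i → (suc n C suc i) * f (suc i) ≡ (n C i) * f (suc i) + (n C suc i) * f (suc i)
  pascal i = trans (cong (_* f (suc i)) (sym (nCk+nC[k+1]≡[n+1]C[k+1] n i)))
                   (*-distribʳ-+ (f (suc i)) (n C i) (n C suc i))
  rearrange : ∀ x y w → x + (y + w) ≡ x + w + y
  rearrange = solve-∀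

-- The sums Σ₁ of the theorem, indexed by the complement n - j, are the transform
-- without its top term (by the symmetry C(n,j) = C(n,n-j)).
binom-Σ₁ : ∀ (f : ℕ → ℕ) n → f n + Σ₁ n (λ j → (n C j) * f (n ∸ j)) ≡ binom f n
binom-Σ₁ f n = begin
  f n + Σ₁ n (λ j → (n C j) * f (n ∸ j))
    ≡⟨ cong₂ _+_ (sym (*-identityˡ (f n))) (sum-applyUpTo n suc (λ j → (n C j) * f (n ∸ j))) ⟩
  Σ< (suc n) (λ j → (n C j) * f (n ∸ j))
    ≡⟨ Σ<-cong< (suc n) (λ j j≤n → cong (_* f (n ∸ j)) (nCk≡nC[n∸k] (≤-pred j≤n))) ⟩
  Σ< (suc n) (λ j → (n C (n ∸ j)) * f (n ∸ j))
    ≡⟨ sym (Σ<-reverse n (λ i → (n C i) * f i)) ⟩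
  binom f n ∎
  where open ≡-Reasoning

𝟙 : Bool → ℕ
𝟙 true  = 1
𝟙 false = 0

private
  variable
    A B : Set

count : (A → Bool) → List A → ℕ
count p []       = 0
count p (x ∷ xs) = 𝟙 (p x) + count p xs

length-filterᵇ : (p : A → Bool) (xs : List A) → length (filterᵇ p xs) ≡ count p xs
length-filterᵇ p []       = refl
length-filterᵇ p (x ∷ xs) with p x
... | true  = cong suc (length-filterᵇ p xs)
... | false = length-filterᵇ p xs

count-++ : (p : A → Bool) (xs ys : List A) → count p (xs ++ ys) ≡ count p xs + count p ys
count-++ p []       ys = refl
count-++ p (x ∷ xs) ys = trans (cong (𝟙 (p x) +_) (count-++ p xs ys)) (sym (+-assoc (𝟙 (p x)) _ _))

count-cong : {p q : A → Bool} (xs : List A) → (∀ x → p x ≡ q x) → count p xs ≡ count q xs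
count-cong []       e = refl
count-cong (x ∷ xs) e = cong₂ _+_ (cong 𝟙 (e x)) (count-cong xs e)

count-none : {p : A → Bool} (xs : List A) → (∀ x → p x ≡ false) → count p xs ≡ 0
count-none []       e = refl
count-none (x ∷ xs) e = cong₂ _+_ (cong 𝟙 (e x)) (count-none xs e)

count-∧ : (b : Bool) (q : A → Bool) (xs : List A) → count (λ x → b ∧ q x) xs ≡ 𝟙 b * count q xs
count-∧ true  q xs = sym (+-identityʳ _)
count-∧ false q xs = count-none xs (λ _ → refl)

count-map : (p : B → Bool) (g : A → B) (xs : List A) → count p (map g xs) ≡ count (p ∘ g) xs
count-map p g []       = refl
count-map p g (x ∷ xs) = cong (𝟙 (p (g x)) +_) (count-map p g xs)

count-concatMap : (p : B → Bool) (f : A → List B) (xs : List A) →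
                  count p (concatMap f xs) ≡ sum (map (count p ∘ f) xs)
count-concatMap p f []       = refl
count-concatMap p f (x ∷ xs) =
  trans (count-++ p (f x) (concatMap f xs)) (cong (count p (f x) +_) (count-concatMap p f xs))

count-concatMap-factor : (p : A → Bool) {q : B → Bool} {f : A → List B} {c : ℕ} (xs : List A) →
  (∀ x → count q (f x) ≡ 𝟙 (p x) * c) → count q (concatMap f xs) ≡ count p xs * c
count-concatMap-factor p []       e = refl
count-concatMap-factor p {q} {f} {c} (x ∷ xs) e = begin
  count q (f x ++ concatMap f xs)             ≡⟨ count-++ q (f x) (concatMap f xs) ⟩
  count q (f x) + count q (concatMap f xs)    ≡⟨ cong₂ _+_ (e x) (count-concatMap-factor p xs e) ⟩
  𝟙 (p x) * c + count p xs * c                ≡⟨ sym (*-distribʳ-+ c (𝟙 (p x)) (count p xs)) ⟩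
  (𝟙 (p x) + count p xs) * c                  ∎
  where open ≡-Reasoning

ΣFin : ∀ {b} → (Fin b → ℕ) → ℕ
ΣFin {zero}  f = 0
ΣFin {suc b} f = f Fin.zero + ΣFin (f ∘ Fin.suc)

every : ∀ {b} → (Fin b → Bool) → Bool
every {zero}  f = true
every {suc b} f = f Fin.zero ∧ every (f ∘ Fin.suc)

ΣFin-cong : ∀ {b} {f g : Fin b → ℕ} → (∀ i → f i ≡ g i) → ΣFin f ≡ ΣFin g
ΣFin-cong {zero}  e = refl
ΣFin-cong {suc b} e = cong₂ _+_ (e Fin.zero) (ΣFin-cong (e ∘ Fin.suc))

ΣFin-vanish : ∀ {b} {f : Fin b → ℕ} → (∀ i → f i ≡ 0) → ΣFin f ≡ 0
ΣFin-vanish {zero}  e = refl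
ΣFin-vanish {suc b} e = cong₂ _+_ (e Fin.zero) (ΣFin-vanish (e ∘ Fin.suc))

every-cong : ∀ {b} {f g : Fin b → Bool} → (∀ i → f i ≡ g i) → every f ≡ every g
every-cong {zero}  e = refl
every-cong {suc b} e = cong₂ _∧_ (e Fin.zero) (every-cong (e ∘ Fin.suc))

sum-tabulate : ∀ {b} (g : Fin b → A) (f : A → ℕ) → sum (map f (tabulate g)) ≡ ΣFin (f ∘ g)
sum-tabulate {b = zero}  g f = refl
sum-tabulate {b = suc b} g f = cong (f (g Fin.zero) +_) (sum-tabulate (g ∘ Fin.suc) f)

all-tabulate : ∀ {b} (g : Fin b → A) (f : A → Bool) → all f (tabulate g) ≡ every (f ∘ g)
all-tabulate {b = zero}  g f = refl
all-tabulate {b = suc b} g f = cong (f (g Fin.zero) ∧_) (all-tabulate (g ∘ Fin.suc) f)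

count-concatMap-allFin : ∀ {b} (p : B → Bool) (f : Fin b → List B) →
                         count p (concatMap f (allFin b)) ≡ ΣFin (count p ∘ f)
count-concatMap-allFin {b = b} p f =
  trans (count-concatMap p f (allFin b)) (sum-tabulate id (count p ∘ f))

-- Kronecker delta at 0: the number of maps from the empty set that hit s given points.
δ₀ : ℕ → ℕ
δ₀ zero    = 1
δ₀ (suc s) = 0

-- How a count φ s t of maps into a set of s marked and t unmarked points grows when one
-- element is added to the domain: it is sent either to one of the s marked points (which
-- then no longer needs to be hit) or to one of the t unmarked points.
step : (ℕ → ℕ → ℕ) → ℕ → ℕ → ℕ
step φ zero    t = t * φ zero t
step φ (suc s) t = suc s * φ s (suc t) + t * φ (suc s) t

-- cov n s t : the number of maps from an n-element set to a set of s marked and t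
-- unmarked points that hit every marked point.
cov : ℕ → ℕ → ℕ → ℕ
cov zero    s t = δ₀ s
cov (suc n) s t = step (cov n) s t

-- blocks n r = a(n,r): the ways to distribute {1..n} into R*, R₁, …, Rᵣ with every
-- ordinary block nonempty (R* already contains *).
blocks : ℕ → ℕ → ℕ
blocks n r = cov n r 1

marked : ∀ {b} → Vec Bool b → ℕ
marked []          = 0
marked (true ∷ S)  = suc (marked S)
marked (false ∷ S) = marked S

unmarked : ∀ {b} → Vec Bool b → ℕ
unmarked []          = 0
unmarked (true ∷ S)  = unmarked S
unmarked (false ∷ S) = suc (unmarked S)

unmark : ∀ {b} → Vec Bool b → Fin b → Vec Bool b
unmark (s ∷ S) Fin.zero    = false ∷ S
unmark (s ∷ S) (Fin.suc x) = s ∷ unmark S x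

occurs : ∀ {b n} → Fin b → Vec (Fin b) n → Bool
occurs j w = any (λ y → ⌊ j Fin.≟ y ⌋) (Vec.toList w)

hitsMarked : ∀ {b n} → Vec Bool b → Vec (Fin b) n → Bool
hitsMarked S w = every (λ j → not (Vec.lookup S j) ∨ occurs j w)

lookup-unmark : ∀ {b} (S : Vec Bool b) x j →
                Vec.lookup (unmark S x) j ≡ (Vec.lookup S j ∧ not ⌊ j Fin.≟ x ⌋)
lookup-unmark (s ∷ S) Fin.zero    Fin.zero    = sym (∧-zeroʳ s)
lookup-unmark (s ∷ S) Fin.zero    (Fin.suc j) = sym (∧-identityʳ _)
lookup-unmark (s ∷ S) (Fin.suc x) Fin.zero    = sym (∧-identityʳ s)
lookup-unmark (s ∷ S) (Fin.suc x) (Fin.suc j) =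
  trans (lookup-unmark S x j)
        (cong (λ q → Vec.lookup S j ∧ not q) (sym (⌊⌋-map′ (cong Fin.suc) FinP.suc-injective (j Fin.≟ x))))

hitsMarked-∷ : ∀ {b n} (S : Vec Bool b) (x : Fin b) (w : Vec (Fin b) n) →
               hitsMarked S (x ∷ w) ≡ hitsMarked (unmark S x) w
hitsMarked-∷ S x w = every-cong (λ j →
  trans (absorb (Vec.lookup S j) ⌊ j Fin.≟ x ⌋ (occurs j w))
        (cong (λ q → not q ∨ occurs j w) (sym (lookup-unmark S x j))))
  where
  absorb : ∀ s c o → (not s ∨ (c ∨ o)) ≡ (not (s ∧ not c) ∨ o)
  absorb true  true  o = refl
  absorb false true  o = refl
  absorb true  false o = refl
  absorb false false o = refl

hitsMarked-[] : ∀ {b} (S : Vec Bool b) → 𝟙 (hitsMarked S []) ≡ δ₀ (marked S)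
hitsMarked-[] []          = refl
hitsMarked-[] (true ∷ S)  = refl
hitsMarked-[] (false ∷ S) = hitsMarked-[] S

-- Summing over the image x of a new element: unmarking x turns (s,t) into (s-1,t+1)
-- when x is marked and leaves it unchanged otherwise — which is exactly  step.
ΣFin-unmark : ∀ {b} (φ : ℕ → ℕ → ℕ) (S : Vec Bool b) →
  ΣFin (λ x → φ (marked (unmark S x)) (unmarked (unmark S x))) ≡ step φ (marked S) (unmarked S)
ΣFin-unmark φ []          = refl
ΣFin-unmark φ (true ∷ S)  =
  trans (cong (φ (marked S) (suc (unmarked S)) +_) (ΣFin-unmark (λ s t → φ (suc s) t) S))
        (first-marked (marked S) (unmarked S))
  where
  first-marked : ∀ s t → φ s (suc t) + step (λ s t → φ (suc s) t) s t ≡ step φ (suc s) t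
  first-marked zero    t = cong (_+ t * φ 1 t) (sym (*-identityˡ _))
  first-marked (suc s) t = sym (+-assoc (φ (suc s) (suc t)) _ _)
ΣFin-unmark φ (false ∷ S) =
  trans (cong (φ (marked S) (suc (unmarked S)) +_) (ΣFin-unmark (λ s t → φ s (suc t)) S))
        (first-unmarked (marked S) (unmarked S))
  where
  first-unmarked : ∀ s t → φ s (suc t) + step (λ s t → φ s (suc t)) s t ≡ step φ s (suc t)
  first-unmarked zero    t = refl
  first-unmarked (suc s) t = swap (φ (suc s) (suc t)) (suc s * φ s (suc (suc t))) (t * φ (suc s) (suc t))
    where
    swap : ∀ x y z → x + (y + z) ≡ y + (x + z)
    swap = solve-∀

cov-count : ∀ {b} n (S : Vec Bool b) →
            count (hitsMarked S) (allFinVecs b n) ≡ cov n (marked S) (unmarked S)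
cov-count zero    S = trans (+-identityʳ _) (hitsMarked-[] S)
cov-count {b} (suc n) S = begin
  count (hitsMarked S) (concatMap (λ x → map (x ∷_) (allFinVecs b n)) (allFin b))
    ≡⟨ count-concatMap-allFin (hitsMarked S) (λ x → map (x ∷_) (allFinVecs b n)) ⟩
  ΣFin (λ x → count (hitsMarked S) (map (x ∷_) (allFinVecs b n)))
    ≡⟨ ΣFin-cong (λ x → trans (count-map (hitsMarked S) (x ∷_) (allFinVecs b n))
         (trans (count-cong (allFinVecs b n) (hitsMarked-∷ S x)) (cov-count n (unmark S x)))) ⟩
  ΣFin (λ x → cov n (marked (unmark S x)) (unmarked (unmark S x)))
    ≡⟨ ΣFin-unmark (cov n) S ⟩
  cov (suc n) (marked S) (unmarked S) ∎
  where open ≡-Reasoning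

surjective?-hitsMarked : ∀ {b n} (v : Vec (Fin b) n) →
                         surjective? v ≡ hitsMarked (Vec.replicate b true) v
surjective?-hitsMarked {b} v =
  trans (all-tabulate id (λ j → occurs j v))
        (every-cong (λ j → cong (λ q → not q ∨ occurs j v) (sym (VecP.lookup-replicate j true))))

marked-all : ∀ b → marked (Vec.replicate b true) ≡ b
marked-all zero    = refl
marked-all (suc b) = cong suc (marked-all b)

unmarked-all : ∀ b → unmarked (Vec.replicate b true) ≡ 0
unmarked-all zero    = refl
unmarked-all (suc b) = unmarked-all b

pointedSurjective : ∀ {n r} → Vec (Fin (suc r)) (suc n) → Bool
pointedSurjective v = ⌊ Vec.head v Fin.≟ Fin.zero ⌋ ∧ surjective? v

pointedSurjective-count : ∀ n r → count pointedSurjective (allFinVecs (suc r) (suc n)) ≡ blocks n r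
pointedSurjective-count n r = begin
  count PS (concatMap (λ x → map (x ∷_) W) (allFin (suc r)))
    ≡⟨ count-concatMap-allFin PS (λ x → map (x ∷_) W) ⟩
  count PS (map (Fin.zero ∷_) W) + ΣFin (λ y → count PS (map (Fin.suc y ∷_) W))
    ≡⟨ cong₂ _+_ star-in-R* (ΣFin-vanish (λ y →
         trans (count-map PS (Fin.suc y ∷_) W) (count-none W (λ _ → refl)))) ⟩
  blocks n r + 0
    ≡⟨ +-identityʳ _ ⟩
  blocks n r ∎
  where
  open ≡-Reasoning
  PS : Vec (Fin (suc r)) (suc n) → Bool
  PS = pointedSurjective
  W : List (Vec (Fin (suc r)) n)
  W = allFinVecs (suc r) n
  -- With * sent to R*, the other n elements must hit the r ordinary blocks.
  star-in-R* : count PS (map (Fin.zero ∷_) W) ≡ blocks n r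
  star-in-R* = begin
    count PS (map (Fin.zero ∷_) W)
      ≡⟨ count-map PS (Fin.zero ∷_) W ⟩
    count (λ w → surjective? (Fin.zero ∷ w)) W
      ≡⟨ count-cong W (λ w → trans (surjective?-hitsMarked (Fin.zero ∷ w))
                                   (hitsMarked-∷ (Vec.replicate (suc r) true) Fin.zero w)) ⟩
    count (hitsMarked (false ∷ Vec.replicate r true)) W
      ≡⟨ cov-count n (false ∷ Vec.replicate r true) ⟩
    cov n (marked (Vec.replicate r true)) (suc (unmarked (Vec.replicate r true)))
      ≡⟨ cong₂ (λ s t → cov n s (suc t)) (marked-all r) (unmarked-all r) ⟩
    blocks n r ∎

-- bars r m = C(r+m, m): the ways to place m indistinguishable bars into r+1 gaps.
bars : ℕ → ℕ → ℕ
bars zero    m       = 1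
bars (suc r) zero    = 1
bars (suc r) (suc m) = bars (suc r) m + bars r (suc m)

bars-zero : ∀ r → bars r 0 ≡ 1
bars-zero zero    = refl
bars-zero (suc r) = refl

-- compositions a s : the number of vectors in ℕᵃ with entry sum s.
compositions : ℕ → ℕ → ℕ
compositions zero    s = δ₀ s
compositions (suc a) s = bars a s

-- Splitting off the first entry x ≤ s of a composition (a hockey-stick identity).
compositions-suc : ∀ a s → Σ< (suc s) (compositions a) ≡ compositions (suc a) s
compositions-suc zero    s = cong suc (Σ<-zeros s)
compositions-suc (suc a) zero    = trans (+-identityʳ _) (bars-zero a)
compositions-suc (suc a) (suc s) =
  trans (Σ<-snoc (suc s) (bars a)) (cong (_+ bars a (suc s)) (compositions-suc (suc a) s))

≟-suc : ∀ x y → ⌊ suc x ≟ suc y ⌋ ≡ ⌊ x ≟ y ⌋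
≟-suc x y = trans (⌊⌋-map′ (≡ᵇ⇒≡ (suc x) (suc y)) (≡⇒≡ᵇ (suc x) (suc y)) (T? (x ≡ᵇ y)))
                  (sym (⌊⌋-map′ (≡ᵇ⇒≡ x y) (≡⇒≡ᵇ x y) (T? (x ≡ᵇ y))))

sum-is-small : ∀ x y s → x ≤ s → ⌊ x + y ≟ s ⌋ ≡ ⌊ y ≟ s ∸ x ⌋
sum-is-small zero    y s       _         = refl
sum-is-small (suc x) y (suc s) (s≤s x≤s) = trans (≟-suc (x + y) s) (sum-is-small x y s x≤s)

sum-is-large : ∀ x y s → s < x → ⌊ x + y ≟ s ⌋ ≡ false
sum-is-large (suc x) y zero    _         = refl
sum-is-large (suc x) y (suc s) (s≤s s<x) = trans (≟-suc (x + y) s) (sum-is-large x y s s<x)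

bars-count : ∀ M a s → s ≤ M → count (λ v → ⌊ Vec.sum v ≟ s ⌋) (boundedVecs M a) ≡ compositions a s
bars-count M zero    s _   = trans (+-identityʳ _) (empty-sum s)
  where
  empty-sum : ∀ s → 𝟙 ⌊ 0 ≟ s ⌋ ≡ δ₀ s
  empty-sum zero    = refl
  empty-sum (suc s) = refl
bars-count M (suc a) s s≤M = begin
  count P (concatMap (λ x → map (x ∷_) (boundedVecs M a)) (upTo (suc M)))
    ≡⟨ count-concatMap P (λ x → map (x ∷_) (boundedVecs M a)) (upTo (suc M)) ⟩
  sum (map first (upTo (suc M)))
    ≡⟨ sum-applyUpTo (suc M) id first ⟩
  Σ< (suc M) first
    ≡⟨ Σ<-extend first (s≤s s≤M) too-large ⟩
  Σ< (suc s) first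
    ≡⟨ Σ<-cong< (suc s) (λ x x≤s → small (≤-pred x≤s)) ⟩
  Σ< (suc s) (λ x → compositions a (s ∸ x))
    ≡⟨ sym (Σ<-reverse s (compositions a)) ⟩
  Σ< (suc s) (compositions a)
    ≡⟨ compositions-suc a s ⟩
  compositions (suc a) s ∎
  where
  open ≡-Reasoning
  P : Vec ℕ (suc a) → Bool
  P v = ⌊ Vec.sum v ≟ s ⌋
  first : ℕ → ℕ
  first x = count P (map (x ∷_) (boundedVecs M a))
  too-large : ∀ x → suc s ≤ x → first x ≡ 0
  too-large x s<x = trans (count-map P (x ∷_) (boundedVecs M a))
    (count-none (boundedVecs M a) (λ v → sum-is-large x (Vec.sum v) s s<x))
  small : ∀ {x} → x ≤ s → first x ≡ compositions a (s ∸ x)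
  small {x} x≤s = trans (count-map P (x ∷_) (boundedVecs M a))
    (trans (count-cong (boundedVecs M a) (λ v → sum-is-small x (Vec.sum v) s x≤s))
           (bars-count M a (s ∸ x) (≤-trans (m∸n≤m s x) s≤M)))

-- The Callan sequences with r ordinary pairs are independent choices of the red
-- partition, the blue partition and the bars.
countR-formula : ∀ n k m r → countR n k m r ≡ blocks n r * (blocks k r * bars r m)
countR-formula n k m r = begin
  length (filterᵇ isB (allCallanData n k m r))
    ≡⟨ length-filterᵇ isB (allCallanData n k m r) ⟩
  count isB (allCallanData n k m r)
    ≡⟨ count-concatMap-factor PS (allFinVecs (suc r) (suc n)) per-red ⟩
  count PS (allFinVecs (suc r) (suc n)) * (count PS Y * count barsOK Z)
    ≡⟨ cong₂ (λ x y → x * (y * count barsOK Z)) (pointedSurjective-count n r) (pointedSurjective-count k r) ⟩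
  blocks n r * (blocks k r * count barsOK Z)
    ≡⟨ cong (λ z → blocks n r * (blocks k r * z)) (bars-count m (suc r) m ≤-refl) ⟩
  blocks n r * (blocks k r * bars r m) ∎
  where
  open ≡-Reasoning
  isB = isBarredCallan n k m r
  Y = allFinVecs (suc r) (suc k)
  Z = boundedVecs m (suc r)
  PS : ∀ {l} → Vec (Fin (suc r)) (suc l) → Bool
  PS = pointedSurjective
  barsOK : Vec ℕ (suc r) → Bool
  barsOK v = ⌊ Vec.sum v ≟ m ⌋
  regroup : ∀ a b c d e → (a ∧ (b ∧ (c ∧ (d ∧ e)))) ≡ (((a ∧ c) ∧ (b ∧ d)) ∧ e)
  regroup false b     c     d e = refl
  regroup true  false false d e = refl
  regroup true  false true  d e = refl
  regroup true  true  false d e = refl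
  regroup true  true  true  d e = refl
  per-blue : ∀ red blue → count isB (map (λ bs → red , blue , bs) Z) ≡ 𝟙 (PS red ∧ PS blue) * count barsOK Z
  per-blue red blue = begin
    count isB (map (λ bs → red , blue , bs) Z)
      ≡⟨ count-map isB (λ bs → red , blue , bs) Z ⟩
    count (λ bs → isB (red , blue , bs)) Z
      ≡⟨ count-cong Z (λ bs → regroup ⌊ Vec.head red Fin.≟ Fin.zero ⌋ ⌊ Vec.head blue Fin.≟ Fin.zero ⌋
                                      (surjective? red) (surjective? blue) (barsOK bs)) ⟩
    count (λ bs → (PS red ∧ PS blue) ∧ barsOK bs) Z
      ≡⟨ count-∧ (PS red ∧ PS blue) barsOK Z ⟩
    𝟙 (PS red ∧ PS blue) * count barsOK Z ∎
  per-red : ∀ red → count isB (concatMap (λ blue → map (λ bs → red , blue , bs) Z) Y)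
                    ≡ 𝟙 (PS red) * (count PS Y * count barsOK Z)
  per-red red = begin
    count isB (concatMap (λ blue → map (λ bs → red , blue , bs) Z) Y)
      ≡⟨ count-concatMap-factor (λ blue → PS red ∧ PS blue) Y (per-blue red) ⟩
    count (λ blue → PS red ∧ PS blue) Y * count barsOK Z
      ≡⟨ cong (_* count barsOK Z) (count-∧ (PS red) PS Y) ⟩
    𝟙 (PS red) * count PS Y * count barsOK Z
      ≡⟨ *-assoc (𝟙 (PS red)) _ _ ⟩
    𝟙 (PS red) * (count PS Y * count barsOK Z) ∎

cov-vanish : ∀ n s t → n < s → cov n s t ≡ 0
cov-vanish zero    (suc s) t _ = refl
cov-vanish (suc n) (suc s) t (s≤s n<s) =
  trans (cong₂ (λ x y → suc s * x + t * y) (cov-vanish n s (suc t) n<s) (cov-vanish n (suc s) t (m<n⇒m<1+n n<s)))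
        (cong₂ _+_ (*-zeroʳ (suc s)) (*-zeroʳ t))

𝒞-formula : ∀ {N} n k m → n < N → 𝒞 n k m ≡ Σ< N (λ r → blocks n r * (blocks k r * bars r m))
𝒞-formula {N} n k m n<N =
  trans (up-to-n n k) (sym (Σ<-extend _ n<N (λ r n<r → cong (_* _) (cov-vanish n r 1 n<r))))
  where
  blocks-zero : ∀ l → blocks l 0 ≡ 1
  blocks-zero zero    = refl
  blocks-zero (suc l) = trans (+-identityʳ _) (blocks-zero l)
  up-to-n : ∀ n k → 𝒞 n k m ≡ Σ< (suc n) (λ r → blocks n r * (blocks k r * bars r m))
  up-to-n zero    k       = sym (trans (+-identityʳ _) (trans (+-identityʳ _) (trans (*-identityʳ _) (blocks-zero k))))
  up-to-n (suc p) zero    = sym (cong₂ _+_ (cong (_* 1) (blocks-zero (suc p)))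
                                           (trans (Σ<-cong (suc p) (λ r → *-zeroʳ (blocks (suc p) (suc r))))
                                                  (Σ<-zeros (suc p))))
  up-to-n (suc p) (suc l) = trans (sum-applyUpTo (suc (suc p)) id (countR (suc p) (suc l) m))
                                  (Σ<-cong (suc (suc p)) (countR-formula (suc p) (suc l) m))

-- One more unmarked point: either it is hit (and may be regarded as marked) or not.
cov-split : ∀ n s t → cov n s (suc t) ≡ cov n (suc s) t + cov n s t
cov-split zero    s       t = refl
cov-split (suc n) zero    t = begin
  suc t * cov n 0 (suc t)
    ≡⟨ cong (suc t *_) (cov-split n zero t) ⟩
  suc t * (cov n 1 t + cov n 0 t)
    ≡⟨ regroup t (cov n 1 t) (cov n 0 t) ⟩
  (1 * (cov n 1 t + cov n 0 t) + t * cov n 1 t) + t * cov n 0 t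
    ≡⟨ cong (λ x → (1 * x + t * cov n 1 t) + t * cov n 0 t) (sym (cov-split n zero t)) ⟩
  cov (suc n) 1 t + cov (suc n) 0 t ∎
  where
  open ≡-Reasoning
  regroup : ∀ t x y → suc t * (x + y) ≡ (1 * (x + y) + t * x) + t * y
  regroup = solve-∀
cov-split (suc n) (suc s) t = begin
  suc s * cov n s (suc (suc t)) + suc t * cov n (suc s) (suc t)
    ≡⟨ cong₂ (λ x y → suc s * x + suc t * y)
         (trans (cov-split n s (suc t)) (cong (_+ cov n s (suc t)) (cov-split n (suc s) t)))
         (cov-split n (suc s) t) ⟩
  suc s * ((C₂ + C₁) + D) + suc t * (C₂ + C₁)
    ≡⟨ regroup s t D C₂ C₁ ⟩
  (suc (suc s) * (C₂ + C₁) + t * C₂) + (suc s * D + t * C₁)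
    ≡⟨ cong (λ x → (suc (suc s) * x + t * C₂) + (suc s * D + t * C₁)) (sym (cov-split n (suc s) t)) ⟩
  cov (suc n) (suc (suc s)) t + cov (suc n) (suc s) t ∎
  where
  open ≡-Reasoning
  D  = cov n s (suc t)
  C₁ = cov n (suc s) t
  C₂ = cov n (suc (suc s)) t
  regroup : ∀ s t D C₂ C₁ → suc s * ((C₂ + C₁) + D) + suc t * (C₂ + C₁)
                          ≡ (suc (suc s) * (C₂ + C₁) + t * C₂) + (suc s * D + t * C₁)
  regroup = solve-∀

-- Binomial transform of cov: choosing which i elements avoid one extra free point.
cov-binom : ∀ n s t → binom (λ i → cov i s t) n ≡ cov n s (suc t)
cov-binom zero    s       t = trans (+-identityʳ _) (*-identityˡ (δ₀ s))
cov-binom (suc n) zero    t = begin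
  binom (λ i → cov i 0 t) (suc n)
    ≡⟨ binom-suc (λ i → cov i 0 t) n ⟩
  binom (λ i → cov i 0 t) n + binom (λ i → t * cov i 0 t) n
    ≡⟨ cong₂ _+_ (cov-binom n zero t) (trans (binom-* n t (λ i → cov i 0 t)) (cong (t *_) (cov-binom n zero t))) ⟩
  cov (suc n) 0 (suc t) ∎
  where open ≡-Reasoning
cov-binom (suc n) (suc s) t = begin
  binom (λ i → cov i (suc s) t) (suc n)
    ≡⟨ binom-suc (λ i → cov i (suc s) t) n ⟩
  binom (λ i → cov i (suc s) t) n + binom (λ i → suc s * cov i s (suc t) + t * cov i (suc s) t) n
    ≡⟨ cong (binom (λ i → cov i (suc s) t) n +_)
         (trans (binom-+ n (λ i → suc s * cov i s (suc t)) (λ i → t * cov i (suc s) t))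
                (cong₂ _+_ (binom-* n (suc s) (λ i → cov i s (suc t))) (binom-* n t (λ i → cov i (suc s) t)))) ⟩
  binom (λ i → cov i (suc s) t) n + (suc s * binom (λ i → cov i s (suc t)) n + t * binom (λ i → cov i (suc s) t) n)
    ≡⟨ cong₂ (λ x y → x + (suc s * y + t * x)) (cov-binom n (suc s) t) (cov-binom n s (suc t)) ⟩
  X + (suc s * Y + t * X)
    ≡⟨ swap X (suc s * Y) (t * X) ⟩
  cov (suc n) (suc s) (suc t) ∎
  where
  open ≡-Reasoning
  X = cov n (suc s) (suc t)
  Y = cov n s (suc (suc t))
  swap : ∀ x y z → x + (y + z) ≡ y + (x + z)
  swap = solve-∀

-- Where the last element goes: into any of the r+1 blocks, or alone into a new ordinary
-- block, i.e.  a(k+1,r+1) = (r+2)·a(k,r+1) + (r+1)·a(k,r).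
blocks-suc : ∀ k r → blocks (suc k) (suc r) ≡ suc (suc r) * blocks k (suc r) + suc r * blocks k r
blocks-suc k r =
  trans (cong₂ (λ x y → suc r * x + y) (cov-split k r 1) (+-identityʳ _)) (regroup r (blocks k (suc r)) (blocks k r))
  where
  regroup : ∀ r B₁ B₀ → suc r * (B₁ + B₀) + B₁ ≡ suc (suc r) * B₁ + suc r * B₀
  regroup = solve-∀

blocks-binom : ∀ n r → binom (λ i → blocks i r) n ≡ blocks n r + blocks n (suc r)
blocks-binom n r = trans (cov-binom n r 1) (trans (cov-split n r 1) (+-comm (blocks n (suc r)) (blocks n r)))

Σ₁-blocks : ∀ n r → Σ₁ n (λ j → (n C j) * blocks (n ∸ j) r) ≡ blocks n (suc r)
Σ₁-blocks n r = +-cancelˡ-≡ (blocks n r) _ _ (trans (binom-Σ₁ (λ i → blocks i r) n) (blocks-binom n r))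

Σ₁-blocks-suc : ∀ n r →
  Σ₁ n (λ j → (n C j) * blocks (n ∸ j + 1) r) ≡ r * blocks n r + suc r * blocks n (suc r)
Σ₁-blocks-suc n r = +-cancelˡ-≡ (A₀ + A₁ + blocks (suc n) r) _ _ (begin
  A₀ + A₁ + blocks (suc n) r + Y
    ≡⟨ +-assoc (A₀ + A₁) _ Y ⟩
  (A₀ + A₁) + (blocks (suc n) r + Y)
    ≡⟨ cong₂ _+_ (sym (blocks-binom n r)) shifted ⟩
  binom (λ i → blocks i r) n + binom (λ i → blocks (suc i) r) n
    ≡⟨ sym (binom-suc (λ i → blocks i r) n) ⟩
  binom (λ i → blocks i r) (suc n)
    ≡⟨ trans (blocks-binom (suc n) r) (cong (blocks (suc n) r +_) (blocks-suc n r)) ⟩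
  blocks (suc n) r + (suc (suc r) * A₁ + suc r * A₀)
    ≡⟨ regroup r A₀ A₁ (blocks (suc n) r) ⟩
  A₀ + A₁ + blocks (suc n) r + (r * A₀ + suc r * A₁) ∎)
  where
  open ≡-Reasoning
  A₀ = blocks n r
  A₁ = blocks n (suc r)
  Y  = Σ₁ n (λ j → (n C j) * blocks (n ∸ j + 1) r)
  shifted : blocks (suc n) r + Y ≡ binom (λ i → blocks (suc i) r) n
  shifted = trans (cong (λ x → blocks x r + Y) (sym (+-comm n 1)))
                  (trans (binom-Σ₁ (λ i → blocks (i + 1) r) n)
                         (binom-cong n (λ i → cong (λ x → blocks x r) (+-comm i 1))))
  regroup : ∀ r A₀ A₁ B → B + (suc (suc r) * A₁ + suc r * A₀) ≡ A₀ + A₁ + B + (r * A₀ + suc r * A₁)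
  regroup = solve-∀

bars-factorial : ∀ a s → bars a s * (a ! * s !) ≡ (a + s) !
bars-factorial zero    s       = trans (+-identityʳ _) (+-identityʳ _)
bars-factorial (suc a) zero    = trans (+-identityʳ _) (trans (*-identityʳ _) (cong _! (sym (+-identityʳ (suc a)))))
bars-factorial (suc a) (suc s) = begin
  (U₁ + U₂) * ((suc a * a !) * (suc s * s !))
    ≡⟨ distribute U₁ U₂ (suc a) (a !) (suc s) (s !) ⟩
  suc s * (U₁ * ((suc a * a !) * s !)) + suc a * (U₂ * (a ! * (suc s * s !)))
    ≡⟨ cong₂ (λ x y → suc s * x + suc a * y) (bars-factorial (suc a) s)
         (trans (bars-factorial a (suc s)) (cong _! (+-suc a s))) ⟩
  suc s * P + suc a * P
    ≡⟨ collect a s P ⟩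
  suc (suc (a + s)) * P
    ≡⟨ cong _! (cong suc (sym (+-suc a s))) ⟩
  (suc a + suc s) ! ∎
  where
  open ≡-Reasoning
  U₁ = bars (suc a) s
  U₂ = bars a (suc s)
  P  = (suc (a + s)) !
  distribute : ∀ U₁ U₂ sa A ss S → (U₁ + U₂) * ((sa * A) * (ss * S))
                                 ≡ ss * (U₁ * ((sa * A) * S)) + sa * (U₂ * (A * (ss * S)))
  distribute = solve-∀
  collect : ∀ a s P → suc s * P + suc a * P ≡ suc (suc (a + s)) * P
  collect = solve-∀

bars-ratio : ∀ r m → suc r * bars (suc r) m ≡ (suc r + m) * bars r m
bars-ratio r m = *-cancelʳ-≡ _ _ (r ! * m !) {{r !* m !≢0}} (begin
  suc r * bars (suc r) m * (r ! * m !)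
    ≡⟨ reassociate (suc r) (bars (suc r) m) (r !) (m !) ⟩
  bars (suc r) m * ((suc r * r !) * m !)
    ≡⟨ bars-factorial (suc r) m ⟩
  (suc r + m) !
    ≡⟨ cong (suc (r + m) *_) (sym (bars-factorial r m)) ⟩
  (suc r + m) * (bars r m * (r ! * m !))
    ≡⟨ sym (*-assoc (suc r + m) (bars r m) (r ! * m !)) ⟩
  (suc r + m) * bars r m * (r ! * m !) ∎)
  where
  open ≡-Reasoning
  reassociate : ∀ sr U R M → sr * U * (R * M) ≡ U * ((sr * R) * M)
  reassociate = solve-∀

-- Both sides of the recurrence, for fixed n, k-1 and m, as sums over r of a coefficient
-- times X r = a(k-1,r)·u(r,m); E r = a(n,r) and F r = a(n,r+1).
module Recurrence (n k m : ℕ) where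

  E F X : ℕ → ℕ
  E r = blocks n r
  F r = blocks n (suc r)
  X r = blocks k r * bars r m

  coefficient : ℕ → ℕ
  coefficient r = suc r * E r + (suc r + m) * F r

  -- Recurrence in k weighted by bars: a new singleton block r+1 is re-indexed to r.
  carry : ℕ → ℕ
  carry zero    = 0
  carry (suc s) = suc s * blocks k s * bars (suc s) m

  blocks-bars-suc : ∀ r → blocks (suc k) r * bars r m ≡ suc r * X r + carry r
  blocks-bars-suc zero    = trans (cong (_* 1) (+-identityʳ (blocks k 0))) (regroup (blocks k 0))
    where
    regroup : ∀ x → x * 1 ≡ 1 * (x * 1) + 0
    regroup = solve-∀
  blocks-bars-suc (suc s) = trans (cong (_* bars (suc s) m) (blocks-suc k s))
                                  (regroup s (blocks k (suc s)) (blocks k s) (bars (suc s) m))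
    where
    regroup : ∀ s A₁ A₀ U → (suc (suc s) * A₁ + suc s * A₀) * U ≡ suc (suc s) * (A₁ * U) + suc s * A₀ * U
    regroup = solve-∀

  carry-ratio : ∀ s → carry (suc s) ≡ (suc s + m) * X s
  carry-ratio s = begin
    suc s * blocks k s * bars (suc s) m   ≡⟨ *-assoc (suc s) (blocks k s) _ ⟩
    suc s * (blocks k s * bars (suc s) m) ≡⟨ x*[y*z]≡y*[x*z] (suc s) (blocks k s) _ ⟩
    blocks k s * (suc s * bars (suc s) m) ≡⟨ cong (blocks k s *_) (bars-ratio s m) ⟩
    blocks k s * ((suc s + m) * bars s m) ≡⟨ x*[y*z]≡y*[x*z] (blocks k s) (suc s + m) _ ⟩
    (suc s + m) * X s                     ∎
    where
    open ≡-Reasoning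
    x*[y*z]≡y*[x*z] : ∀ x y z → x * (y * z) ≡ y * (x * z)
    x*[y*z]≡y*[x*z] = solve-∀

  lhs : 𝒞 n (suc k) m ≡ Σ< (suc n) (λ r → coefficient r * X r)
  lhs = begin
    𝒞 n (suc k) m
      ≡⟨ 𝒞-formula n (suc k) m (n<1+n n) ⟩
    Σ< (suc n) (λ r → E r * (blocks (suc k) r * bars r m))
      ≡⟨ Σ<-cong (suc n) (λ r → trans (cong (E r *_) (blocks-bars-suc r))
                                      (*-distribˡ-+ (E r) (suc r * X r) (carry r))) ⟩
    Σ< (suc n) (λ r → E r * (suc r * X r) + E r * carry r)
      ≡⟨ Σ<-+ (suc n) (λ r → E r * (suc r * X r)) (λ r → E r * carry r) ⟩
    Σ< (suc n) (λ r → E r * (suc r * X r)) + Σ< (suc n) (λ r → E r * carry r)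
      ≡⟨ cong (Σ< (suc n) (λ r → E r * (suc r * X r)) +_) carried ⟩
    Σ< (suc n) (λ r → E r * (suc r * X r)) + Σ< (suc n) (λ r → F r * ((suc r + m) * X r))
      ≡⟨ sym (Σ<-+ (suc n) (λ r → E r * (suc r * X r)) (λ r → F r * ((suc r + m) * X r))) ⟩
    Σ< (suc n) (λ r → E r * (suc r * X r) + F r * ((suc r + m) * X r))
      ≡⟨ Σ<-cong (suc n) (λ r → collect (E r) (suc r) (X r) (F r) (suc r + m)) ⟩
    Σ< (suc n) (λ r → coefficient r * X r) ∎
    where
    open ≡-Reasoning
    collect : ∀ e a x f b → e * (a * x) + f * (b * x) ≡ (a * e + b * f) * x
    collect = solve-∀
    carried : Σ< (suc n) (λ r → E r * carry r) ≡ Σ< (suc n) (λ r → F r * ((suc r + m) * X r))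
    carried = begin
      E 0 * 0 + Σ< n (λ s → E (suc s) * carry (suc s))
        ≡⟨ cong₂ _+_ (*-zeroʳ (E 0)) (Σ<-cong n (λ s → cong (F s *_) (carry-ratio s))) ⟩
      Σ< n (λ s → F s * ((suc s + m) * X s))
        ≡⟨ sym (Σ<-extend _ (n≤1+n n) (λ i n≤i → cong (_* _) (cov-vanish n (suc i) 1 (s≤s n≤i)))) ⟩
      Σ< (suc n) (λ r → F r * ((suc r + m) * X r)) ∎

  Σ₁-𝒞 : (G : ℕ → ℕ) → (∀ j → j < n → G (suc j) ≤ n) →
    Σ₁ n (λ j → (n C j) * 𝒞 (G j) k m) ≡ Σ< (suc n) (λ r → Σ₁ n (λ j → (n C j) * blocks (G j) r) * X r)
  Σ₁-𝒞 G bounded = begin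
    Σ₁ n (λ j → (n C j) * 𝒞 (G j) k m)
      ≡⟨ sum-applyUpTo n suc (λ j → (n C j) * 𝒞 (G j) k m) ⟩
    Σ< n (λ j → c j * 𝒞 (G (suc j)) k m)
      ≡⟨ Σ<-cong< n (λ j j<n → cong (c j *_) (𝒞-formula (G (suc j)) k m (s≤s (bounded j j<n)))) ⟩
    Σ< n (λ j → c j * Σ< (suc n) (λ r → blocks (G (suc j)) r * X r))
      ≡⟨ Σ<-cong n (λ j → sym (Σ<-*ˡ (suc n) (c j) (λ r → blocks (G (suc j)) r * X r))) ⟩
    Σ< n (λ j → Σ< (suc n) (λ r → c j * (blocks (G (suc j)) r * X r)))
      ≡⟨ Σ<-swap n (suc n) (λ j r → c j * (blocks (G (suc j)) r * X r)) ⟩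
    Σ< (suc n) (λ r → Σ< n (λ j → c j * (blocks (G (suc j)) r * X r)))
      ≡⟨ Σ<-cong (suc n) (λ r → trans (Σ<-cong n (λ j → sym (*-assoc (c j) _ (X r))))
                                      (Σ<-*ʳ n (X r) (λ j → c j * blocks (G (suc j)) r))) ⟩
    Σ< (suc n) (λ r → Σ< n (λ j → c j * blocks (G (suc j)) r) * X r)
      ≡⟨ Σ<-cong (suc n) (λ r → cong (_* X r) (sym (sum-applyUpTo n suc (λ j → (n C j) * blocks (G j) r)))) ⟩
    Σ< (suc n) (λ r → Σ₁ n (λ j → (n C j) * blocks (G j) r) * X r) ∎
    where
    open ≡-Reasoning
    c : ℕ → ℕ
    c j = n C suc j

  rhs : 𝒞 n k m + Σ₁ n (λ j → (n C j) * 𝒞 (n ∸ j + 1) k m)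
                + m * Σ₁ n (λ j → (n C j) * 𝒞 (n ∸ j) k m)
        ≡ Σ< (suc n) (λ r → coefficient r * X r)
  rhs = begin
    𝒞 n k m + Σ₁ n (λ j → (n C j) * 𝒞 (n ∸ j + 1) k m) + m * Σ₁ n (λ j → (n C j) * 𝒞 (n ∸ j) k m)
      ≡⟨ cong₂ _+_ (cong₂ _+_ (𝒞-formula n k m (n<1+n n)) from-suc) (cong (m *_) from-same) ⟩
    Σ< (suc n) (λ r → E r * X r) + Σ< (suc n) (λ r → (r * E r + suc r * F r) * X r)
      + m * Σ< (suc n) (λ r → F r * X r)
      ≡⟨ cong₂ _+_ (sym (Σ<-+ (suc n) (λ r → E r * X r) (λ r → (r * E r + suc r * F r) * X r)))
                   (sym (Σ<-*ˡ (suc n) m (λ r → F r * X r))) ⟩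
    Σ< (suc n) (λ r → E r * X r + (r * E r + suc r * F r) * X r) + Σ< (suc n) (λ r → m * (F r * X r))
      ≡⟨ sym (Σ<-+ (suc n) (λ r → E r * X r + (r * E r + suc r * F r) * X r) (λ r → m * (F r * X r))) ⟩
    Σ< (suc n) (λ r → E r * X r + (r * E r + suc r * F r) * X r + m * (F r * X r))
      ≡⟨ Σ<-cong (suc n) (λ r → collect r m (E r) (F r) (X r)) ⟩
    Σ< (suc n) (λ r → coefficient r * X r) ∎
    where
    open ≡-Reasoning
    from-suc : Σ₁ n (λ j → (n C j) * 𝒞 (n ∸ j + 1) k m) ≡ Σ< (suc n) (λ r → (r * E r + suc r * F r) * X r)
    from-suc = trans (Σ₁-𝒞 (λ j → n ∸ j + 1)
                       (λ j j<n → subst (_≤ n) (+-comm 1 (n ∸ suc j)) (∸-monoʳ-< (s≤s z≤n) j<n)))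
                     (Σ<-cong (suc n) (λ r → cong (_* X r) (Σ₁-blocks-suc n r)))
    from-same : Σ₁ n (λ j → (n C j) * 𝒞 (n ∸ j) k m) ≡ Σ< (suc n) (λ r → F r * X r)
    from-same = trans (Σ₁-𝒞 (λ j → n ∸ j) (λ j _ → m∸n≤m n (suc j)))
                      (Σ<-cong (suc n) (λ r → cong (_* X r) (Σ₁-blocks n r)))
    collect : ∀ r m e f x → e * x + (r * e + suc r * f) * x + m * (f * x) ≡ (suc r * e + (suc r + m) * f) * x
    collect = solve-∀

mainTheorem3 : (n k m : ℕ) → 0 < k →
    𝒞 n k m ≡ 𝒞 n (k ∸ 1) m
    + Σ₁ n (λ j → (n C j) * 𝒞 (n ∸ j + 1) (k ∸ 1) m)
    + m * Σ₁ n (λ j → (n C j) * 𝒞 (n ∸ j) (k ∸ 1) m)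
mainTheorem3 n (suc k) m _ = trans lhs (sym rhs)
  where open Recurrence n k m
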